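{- Let $A$ be a commutative ring with identity and $HA$ the ring of Hurwitz series over $A$. Let $n\in\mathbb{N}^+$ be fixed and $z_0,\dots,z_{n-1}\in HA$. Then for all $k\in\mathbb{N}$, $$\langle k\rangle\,\mathrm{intl}(z_0,\dots,z_{n-1})=\int^k\mathrm{intl}\Big(C^{k}_{k,n}\boxdot z_0,\ \dots,\ C^{i+k}_{k,n}\boxdot z_i,\ \dots,\ C^{n-1+k}_{k,n}\boxdot z_{n-1}\Big).$$
   Context: $HA$ is the set of sequences $f=(f(0),f(1),\dots)$ with entries in $A$, with componentwise addition and product $(fg)(m)=\sum_{i=0}^m\binom{m}{i}f(i)g(m-i)$. The integral is $\int f=(0,f(0),f(1),\dots)$ and $\int^k$ its $k$-fold iterate ($\int^0=\mathrm{id}$). $\langle k\rangle\in HA$ is given by $\langle k\rangle(i)=\delta_{i,k}$. For fixed $n$, $\widehat{q}=\lfloor q/n\rfloor$, $\overline{q}=q-\widehat{q}n$; the interlacing is $\mathrm{intl}(z_0,\dots,z_{n-1})(q)=z_{\overline{q}}(\widehat{q})$. The Hadamard product is $(f\boxdot g)(p)=f(p)g(p)$. $C^{\ell}_{k,n}\in HA$ is defined by $C^{\ell}_{k,n}(p)=\binom{\ell+pn}{k}$ (with $\binom{a}{b}=0$ if $a<b$). -}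

module Defs where

open import Level using (Level)
open import Algebra.Bundles using (CommutativeRing; Semiring)
open import Data.Nat as ℕ using (ℕ; zero; suc; NonZero)
open import Data.Nat.DivMod using (_/_; _mod_)
open import Data.Nat.Combinatorics using (_C_)
open import Data.Fin using (Fin)
import Algebra.Definitions.RawSemiring as RS
open import Relation.Nullary using (yes; no)

module Hurwitz {c ℓ : Level} (R : CommutativeRing c ℓ) where
  open CommutativeRing R
  open RS (Semiring.rawSemiring semiring) using (_×_)

  HA : Set c
  HA = ℕ → Carrier

  infix 4 _≋_
  _≋_ : HA → HA → Set ℓ
  f ≋ g = ∀ m → f m ≈ g m

  sumTo : ℕ → (ℕ → Carrier) → Carrier
  sumTo zero    h = h 0
  sumTo (suc m) h = sumTo m h + h (suc m)

  infixl 7 _·_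
  _·_ : HA → HA → HA
  (f · g) m = sumTo m (λ i → (m C i) × (f i * g (m ℕ.∸ i)))

  ∫ : HA → HA
  ∫ f zero    = 0#
  ∫ f (suc m) = f m

  ∫^ : ℕ → HA → HA
  ∫^ zero    f = f
  ∫^ (suc k) f = ∫ (∫^ k f)

  ⟨_⟩ : ℕ → HA
  ⟨ k ⟩ i with k ℕ.≟ i
  ... | yes _ = 1#
  ... | no  _ = 0#

  intl : (n : ℕ) .{{_ : NonZero n}} → (Fin n → HA) → HA
  intl n z q = z (q mod n) (q / n)

  _⊡_ : HA → HA → HA
  (f ⊡ g) p = f p * g p

  Cf : (l k n : ℕ) → HA
  Cf l k n p = ((l ℕ.+ p ℕ.* n) C k) × 1#

-- Multiplying by ⟨k⟩ shifts a series by k places and weights the entry landing at m by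
-- binom(m, k), because ⟨k⟩ kills every term of the Hurwitz product except i = k.
-- For an interlaced series, position q + k carries the binomial binom(q + k, k), and
-- writing q = i + p n with i = q mod n, p = ⌊q/n⌋ turns this weight into C^{i+k}_{k,n}(p).
module Submission where

open import Defs
open import Level using (Level)
open import Algebra.Bundles using (CommutativeRing)
open import Data.Nat using (ℕ; _+_; _*_; _∸_; _≤_; _<_; _≟_; _≤?_; NonZero; zero; suc; z≤n; s≤s)
open import Data.Nat.Properties
  using (≤-refl; ≤-antisym; ≰⇒>; ≤-trans; n≤1+n; <⇒≢; m∸n+n≡m; +-commutativeSemigroup)
open import Data.Nat.DivMod using (_/_; _mod_; m≡m%n+[m/n]*n)
open import Data.Nat.Combinatorics using (_C_)
open import Data.Fin using (Fin; toℕ)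
open import Data.Fin.Properties using (toℕ-fromℕ<)
open import Relation.Binary.PropositionalEquality as ≡ using (_≡_; _≢_; ≢-sym)
open import Relation.Nullary using (yes; no; contradiction)
open import Algebra.Properties.CommutativeSemigroup +-commutativeSemigroup using (xy∙z≈xz∙y)
import Algebra.Properties.Semiring.Mult as SemiringMult
import Relation.Binary.Reasoning.Setoid as SetoidReasoning

toℕ-mod+div*n : ∀ q n .{{_ : NonZero n}} → toℕ (q mod n) + (q / n) * n ≡ q
toℕ-mod+div*n q n = ≡.trans (≡.cong (_+ (q / n) * n) (toℕ-fromℕ< _)) (≡.sym (m≡m%n+[m/n]*n q n))

module Properties {c ℓ : Level} (R : CommutativeRing c ℓ) where
  open Hurwitz R
  open CommutativeRing R hiding (_+_; _*_; zero)
  open CommutativeRing R using () renaming (_+_ to _⊕_; _*_ to _⊛_)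
  open SemiringMult semiring
  open SetoidReasoning setoid

  sumTo-vanishing : ∀ m (h : ℕ → Carrier) → (∀ i → i ≤ m → h i ≈ 0#) → sumTo m h ≈ 0#
  sumTo-vanishing zero    h h≈0 = h≈0 0 z≤n
  sumTo-vanishing (suc m) h h≈0 = begin
    sumTo m h ⊕ h (suc m) ≈⟨ +-cong (sumTo-vanishing m h (λ i i≤m → h≈0 i (≤-trans i≤m (n≤1+n m))))
                                    (h≈0 (suc m) ≤-refl) ⟩
    0# ⊕ 0#               ≈⟨ +-identityʳ 0# ⟩
    0#                    ∎

  sumTo-single : ∀ k m (h : ℕ → Carrier) → (∀ i → i ≢ k → h i ≈ 0#) → k ≤ m → sumTo m h ≈ h k
  sumTo-single .zero zero h _ z≤n = refl
  sumTo-single k (suc m) h h≈0 k≤1+m with k ≤? m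
  ... | yes k≤m = begin
    sumTo m h ⊕ h (suc m) ≈⟨ +-cong (sumTo-single k m h h≈0 k≤m) (h≈0 (suc m) (≢-sym (<⇒≢ (s≤s k≤m)))) ⟩
    h k ⊕ 0#              ≈⟨ +-identityʳ (h k) ⟩
    h k                   ∎
  ... | no k≰m with ≤-antisym k≤1+m (≰⇒> k≰m)
  ... | ≡.refl = begin
    sumTo m h ⊕ h (suc m) ≈⟨ +-congʳ (sumTo-vanishing m h (λ i i≤m → h≈0 i (<⇒≢ (s≤s i≤m)))) ⟩
    0# ⊕ h (suc m)        ≈⟨ +-identityˡ (h (suc m)) ⟩
    h (suc m)             ∎

  ⟨⟩-diag : ∀ k → ⟨ k ⟩ k ≡ 1#
  ⟨⟩-diag k with k ≟ k
  ... | yes _   = ≡.refl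
  ... | no  k≢k = contradiction ≡.refl k≢k

  ⟨⟩-off : ∀ k i → i ≢ k → ⟨ k ⟩ i ≡ 0#
  ⟨⟩-off k i i≢k with k ≟ i
  ... | yes k≡i = contradiction (≡.sym k≡i) i≢k
  ... | no  _   = ≡.refl

  ⟨⟩·-term-off : ∀ k (f : HA) m i → i ≢ k → (m C i) × (⟨ k ⟩ i ⊛ f (m ∸ i)) ≈ 0#
  ⟨⟩·-term-off k f m i i≢k = begin
    (m C i) × (⟨ k ⟩ i ⊛ f (m ∸ i)) ≈⟨ ×-congʳ (m C i) (*-congʳ (reflexive (⟨⟩-off k i i≢k))) ⟩
    (m C i) × (0# ⊛ f (m ∸ i))      ≈⟨ ×-comm-* (m C i) 0# (f (m ∸ i)) ⟨
    0# ⊛ (m C i) × f (m ∸ i)        ≈⟨ zeroˡ _ ⟩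
    0#                              ∎

  ⟨⟩·-below : ∀ k (f : HA) m → m < k → (⟨ k ⟩ · f) m ≈ 0#
  ⟨⟩·-below k f m m<k = sumTo-vanishing m _ λ i i≤m →
    ⟨⟩·-term-off k f m i (<⇒≢ (≤-trans (s≤s i≤m) m<k))

  ⟨⟩·-above : ∀ k (f : HA) m → k ≤ m → (⟨ k ⟩ · f) m ≈ (m C k) × f (m ∸ k)
  ⟨⟩·-above k f m k≤m = begin
    (⟨ k ⟩ · f) m                   ≈⟨ sumTo-single k m _ (⟨⟩·-term-off k f m) k≤m ⟩
    (m C k) × (⟨ k ⟩ k ⊛ f (m ∸ k)) ≈⟨ ×-congʳ (m C k) (*-congʳ (reflexive (⟨⟩-diag k))) ⟩
    (m C k) × (1# ⊛ f (m ∸ k))      ≈⟨ ×-congʳ (m C k) (*-identityˡ _) ⟩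
    (m C k) × f (m ∸ k)             ∎

  ∫^-below : ∀ k (f : HA) m → m < k → ∫^ k f m ≈ 0#
  ∫^-below (suc k) f zero    _         = refl
  ∫^-below (suc k) f (suc m) (s≤s m<k) = ∫^-below k f m m<k

  ∫^-above : ∀ k (f : HA) m → k ≤ m → ∫^ k f m ≡ f (m ∸ k)
  ∫^-above zero    f m       _         = ≡.refl
  ∫^-above (suc k) f (suc m) (s≤s k≤m) = ∫^-above k f m k≤m

  ∫^-cong : ∀ k {f g} → f ≋ g → ∫^ k f ≋ ∫^ k g
  ∫^-cong zero    f≋g m       = f≋g m
  ∫^-cong (suc k) f≋g zero    = refl
  ∫^-cong (suc k) f≋g (suc m) = ∫^-cong k f≋g m

  ⟨⟩·≋∫^ : ∀ k (f : HA) → (⟨ k ⟩ · f) ≋ ∫^ k (λ p → ((p + k) C k) × f p)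
  ⟨⟩·≋∫^ k f m with k ≤? m
  ... | no k≰m  = trans (⟨⟩·-below k f m (≰⇒> k≰m)) (sym (∫^-below k _ m (≰⇒> k≰m)))
  ... | yes k≤m = begin
    (⟨ k ⟩ · f) m                               ≈⟨ ⟨⟩·-above k f m k≤m ⟩
    (m C k) × f (m ∸ k)                         ≈⟨ ×-congˡ (≡.cong (_C k) (m∸n+n≡m k≤m)) ⟨
    ((m ∸ k + k) C k) × f (m ∸ k)               ≡⟨ ∫^-above k _ m k≤m ⟨
    ∫^ k (λ p → ((p + k) C k) × f p) m          ∎

  ×-intl : ∀ (w : ℕ → ℕ) n .{{_ : NonZero n}} (z : Fin n → HA) →
           (λ q → w q × intl n z q) ≋ intl n (λ i p → w (toℕ i + p * n) × z i p)
  ×-intl w n z q = ×-congˡ (≡.cong w (≡.sym (toℕ-mod+div*n q n)))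

  binomial×≈Cf* : ∀ i k n p (x : Carrier) → ((i + p * n + k) C k) × x ≈ Cf (i + k) k n p ⊛ x
  binomial×≈Cf* i k n p x = begin
    ((i + p * n + k) C k) × x         ≈⟨ ×-congˡ (≡.cong (_C k) (xy∙z≈xz∙y i (p * n) k)) ⟩
    ((i + k + p * n) C k) × x         ≈⟨ ×-congʳ ((i + k + p * n) C k) (*-identityˡ x) ⟨
    ((i + k + p * n) C k) × (1# ⊛ x)  ≈⟨ ×-assoc-* ((i + k + p * n) C k) 1# x ⟨
    ((i + k + p * n) C k) × 1# ⊛ x    ∎

  binomial×intl≋intl-Cf⊡ : ∀ k n .{{_ : NonZero n}} (z : Fin n → HA) →
    (λ q → ((q + k) C k) × intl n z q) ≋ intl n (λ i → Cf (toℕ i + k) k n ⊡ z i)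
  binomial×intl≋intl-Cf⊡ k n z q = trans (×-intl (λ q → (q + k) C k) n z q)
    (binomial×≈Cf* (toℕ (q mod n)) k n (q / n) (z (q mod n) (q / n)))

corollary3p9 : {c ℓ : Level} (R : CommutativeRing c ℓ) → let open Hurwitz R in
    (n : ℕ) .{{_ : NonZero n}} (z : Fin n → HA) (k : ℕ) →
    (⟨ k ⟩ · intl n z) ≋ ∫^ k (intl n (λ i → Cf (toℕ i + k) k n ⊡ z i))
corollary3p9 R n z k m = trans (⟨⟩·≋∫^ k (intl n z) m) (∫^-cong k (binomial×intl≋intl-Cf⊡ k n z) m)
  where
  open Properties R
  open Hurwitz R using (intl)
  open CommutativeRing R using (trans)
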